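{- Let $c,d\ge 2$, let $\ell>1$ be even, and let $G=(L\cup R,E)$ be a bipartite graph in which every left vertex has degree at most $c$ and every right vertex has degree at most $d$. Let $T$ be the depth-$\ell$ $(c,d)$-biregular tree extension of $G$. For $t\in\mathbb{R}$ and $f:V(G)\to\mathbb{R}$, let $f_t:V(T)\to\mathbb{R}$ be $f_t(x)=f(r)t^{\mathrm{depth}(x)}$ for $x\in T_r$. Then $$(H_T(t)f_t)(x)=\begin{cases}(H_G(t)f)(x), & x\in V(G),\\ 0, & x\notin V(G).\end{cases}$$
   Context: The depth-$\ell$ $(c,d)$-biregular tree extension $T$ of $G$ is obtained by attaching to each vertex $r\in V(G)$ a rooted tree $T_r$ with root $r$ and layers $0,1,\dots,\ell$ (layer $0$ is $\{r\}$, $\mathrm{depth}(x)$ is the layer of $x$): if $r\in L$, the root has $c-\deg_G(r)$ children, vertices in odd layers have $d-1$ children, vertices in even layers $1<k<\ell$ have $c-1$ children, and layer $\ell$ consists of leaves; if $r\in R$, the roles of $c$ and $d$ are swapped. $T$ is the union of $G$ and all trees $T_r$. For a graph $F$, the Bethe-Hessian matrix is $H_F(t)=(D_F-I)t^2-A_Ft+I$ with $D_F$ the diagonal degree matrix and $A_F$ the adjacency matrix. -}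

module Defs where

open import Level using (Level)
open import Data.Nat using (ℕ; zero; suc; _∸_; _<ᵇ_)
open import Data.Bool using (Bool; true; false; if_then_else_; not)
open import Data.Fin using (Fin)
open import Data.Sum using (_⊎_; inj₁; inj₂)
open import Data.Product using (Σ; _,_)
open import Data.List using (List; []; _∷_; map; length; _++_; allFin)
open import Algebra.Bundles using (CommutativeRing)

record BipGraph : Set where
  field
    nL  : ℕ
    nR  : ℕ
    adj : Fin nL → Fin nR → Bool

select : ∀ {a} {A : Set a} → (A → Bool) → List A → List A
select p [] = []
select p (x ∷ xs) = if p x then x ∷ select p xs else select p xs

b2n : Bool → ℕ
b2n true = 1
b2n false = 0

sumℕ : List ℕ → ℕ
sumℕ [] = 0
sumℕ (x ∷ xs) = x Data.Nat.+ sumℕ xs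

odd : ℕ → Bool
odd zero = false
odd (suc n) = not (odd n)

module BG (G : BipGraph) where
  open BipGraph G

  V : Set
  V = Fin nL ⊎ Fin nR

  isLeft : V → Bool
  isLeft (inj₁ _) = true
  isLeft (inj₂ _) = false

  allV : List V
  allV = map inj₁ (allFin nL) ++ map inj₂ (allFin nR)

  A : V → V → Bool
  A (inj₁ u) (inj₂ v) = adj u v
  A (inj₂ v) (inj₁ u) = adj u v
  A (inj₁ _) (inj₁ _) = false
  A (inj₂ _) (inj₂ _) = false

  deg : V → ℕ
  deg x = sumℕ (map (λ y → b2n (A x y)) allV)

  nbrsG : V → List V
  nbrsG x = select (A x) allV

module Tree (c d ℓ : ℕ) (G : BipGraph) where
  open BG G public

  nchild : V → ℕ → ℕ
  nchild r zero    = if 0 <ᵇ ℓ then (if isLeft r then c ∸ deg r else d ∸ deg r) else 0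
  nchild r (suc k) =
    if suc k <ᵇ ℓ
    then (if isLeft r
          then (if odd (suc k) then d ∸ 1 else c ∸ 1)
          else (if odd (suc k) then c ∸ 1 else d ∸ 1))
    else 0

  -- vertices of layer k of T_r, as paths of child indices from the root r
  data Path (r : V) : ℕ → Set where
    root  : Path r 0
    child : ∀ {k} → Path r k → Fin (nchild r k) → Path r (suc k)

  -- V(T): a vertex x of T_r at depth k; (r , 0 , root) is identified with r ∈ V(G)
  VT : Set
  VT = Σ V (λ r → Σ ℕ (Path r))

  depth : VT → ℕ
  depth (_ , k , _) = k

  embed : V → VT
  embed r = r , 0 , root

  children : VT → List VT
  children (r , k , p) = map (λ i → r , suc k , child p i) (allFin (nchild r k))

  -- neighbourhood of x in T = G ∪ ⋃_r T_r
  nbrsT : VT → List VT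
  nbrsT (r , zero , root)        = map embed (nbrsG r) ++ children (r , zero , root)
  nbrsT (r , suc k , child p i)  = (r , k , p) ∷ children (r , suc k , child p i)

  module Ops {a b : Level} (Rg : CommutativeRing a b) where
    open CommutativeRing Rg

    fromℕ : ℕ → Carrier
    fromℕ zero = 0#
    fromℕ (suc n) = 1# + fromℕ n

    pow : Carrier → ℕ → Carrier
    pow t zero = 1#
    pow t (suc n) = t * pow t n

    χ : Bool → Carrier
    χ true = 1#
    χ false = 0#

    sumR : List Carrier → Carrier
    sumR [] = 0#
    sumR (x ∷ xs) = x + sumR xs

    HG : Carrier → (V → Carrier) → V → Carrier
    HG t f x = (fromℕ (deg x) - 1#) * (t * t) * f x
               - t * sumR (map (λ y → χ (A x y) * f y) allV)
               + f x

    HT : Carrier → (VT → Carrier) → VT → Carrier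
    HT t g x = (fromℕ (length (nbrsT x)) - 1#) * (t * t) * g x
               - t * sumR (map g (nbrsT x))
               + g x

    lift : Carrier → (V → Carrier) → VT → Carrier
    lift t f (r , k , _) = f r * pow t k

{-# OPTIONS --safe #-}
-- Along each tree T_r the function f_t is multiplied by t from parent to child.  At a vertex x of
-- depth ≥ 1 with n children, t f_t(parent) = f_t(x) cancels the constant term, while the n children
-- contribute n t² f_t(x) to the degree term and −t · n t f_t(x) to the adjacency term, which cancel.
-- At a root r the same cancellation removes the n children and leaves (H_G(t) f)(r).  Nothing here
-- depends on the numbers of children.
module Submission where

open import Defs
open import Data.Nat using (ℕ; zero; suc; _≤_; _<_)
open import Data.Nat.Divisibility using (_∣_)
open import Data.Product using (_×_; _,_)
open import Data.Sum using (inj₁; inj₂)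
open import Level using (Level)
open import Algebra.Bundles using (CommutativeRing)
import Data.Nat as ℕ
open import Data.Bool using (Bool; true; false)
open import Data.List using (List; []; _∷_; map; length; _++_; allFin)
open import Data.List.Properties using (length-map; length-++; length-tabulate; map-++; map-∘)
open import Function using (_∘_; id)
import Relation.Binary.PropositionalEquality as ≡
import Algebra.Properties.CommutativeSemigroup as CommutativeSemigroupProperties
import Algebra.Properties.AbelianGroup as AbelianGroupProperties
import Relation.Binary.Reasoning.Setoid as SetoidReasoning

module BetheHessian {a b : Level} (Rg : CommutativeRing a b) where
  open CommutativeRing Rg
  open SetoidReasoning setoid
  open AbelianGroupProperties +-abelianGroup using (⁻¹-∙-comm)
  open CommutativeSemigroupProperties +-commutativeSemigroup using (interchange; xy∙z≈xz∙y)
  open CommutativeSemigroupProperties *-commutativeSemigroup using (x∙yz≈y∙xz)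

  -- (H_F(t) g)(x) with δ = deg_F x and σ = Σ_{y ∼ x} g y; HG and HT unfold to this.
  hessianAt : Carrier → Carrier → Carrier → Carrier → Carrier
  hessianAt δ t σ x = (δ - 1#) * (t * t) * x - t * σ + x

  hessianAt-cong : ∀ {δ δ′ σ σ′ x x′} t → δ ≈ δ′ → σ ≈ σ′ → x ≈ x′ →
                   hessianAt δ t σ x ≈ hessianAt δ′ t σ′ x′
  hessianAt-cong t δ≈ σ≈ x≈ =
    +-cong (+-cong (*-cong (*-congʳ (+-congʳ δ≈)) x≈) (-‿cong (*-congˡ σ≈))) x≈

  [x+z]-[y+z]≈x-y : ∀ x y z → (x + z) - (y + z) ≈ x - y
  [x+z]-[y+z]≈x-y x y z = begin
    (x + z) + - (y + z)    ≈⟨ +-congˡ (⁻¹-∙-comm y z) ⟨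
    (x + z) + (- y + - z)  ≈⟨ interchange x z (- y) (- z) ⟩
    (x - y) + (z - z)      ≈⟨ +-congˡ (-‿inverseʳ z) ⟩
    (x - y) + 0#           ≈⟨ +-identityʳ (x - y) ⟩
    x - y                  ∎

  hessianAt-children : ∀ δ n t σ x →
                       hessianAt (δ + n) t (σ + n * (t * x)) x ≈ hessianAt δ t σ x
  hessianAt-children δ n t σ x = +-congʳ (begin
      (δ + n - 1#) * (t * t) * x - t * (σ + n * (t * x))
    ≈⟨ +-congʳ (*-congʳ (*-congʳ (xy∙z≈xz∙y δ n (- 1#)))) ⟩
      ((δ - 1#) + n) * (t * t) * x - t * (σ + n * (t * x))
    ≈⟨ +-cong (trans (*-congʳ (distribʳ (t * t) (δ - 1#) n)) (distribʳ x _ _))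
              (-‿cong (distribˡ t σ _)) ⟩
      ((δ - 1#) * (t * t) * x + n * (t * t) * x) - (t * σ + t * (n * (t * x)))
    ≈⟨ +-congʳ (+-congˡ pendants) ⟩
      ((δ - 1#) * (t * t) * x + t * (n * (t * x))) - (t * σ + t * (n * (t * x)))
    ≈⟨ [x+z]-[y+z]≈x-y _ _ _ ⟩
      (δ - 1#) * (t * t) * x - t * σ ∎)
    where
    pendants : n * (t * t) * x ≈ t * (n * (t * x))
    pendants = trans (*-assoc n (t * t) x)
                     (trans (*-congˡ (*-assoc t t x)) (x∙yz≈y∙xz n t (t * x)))

  hessianAt-leaf : ∀ t σ x → t * σ ≈ x → hessianAt 1# t σ x ≈ 0#
  hessianAt-leaf t σ x tσ≈x = begin
      (1# - 1#) * (t * t) * x - t * σ + x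
    ≈⟨ +-congʳ (+-cong (*-congʳ (*-congʳ (-‿inverseʳ 1#))) (-‿cong tσ≈x)) ⟩
      0# * (t * t) * x - x + x
    ≈⟨ +-congʳ (+-congʳ (trans (*-congʳ (zeroˡ (t * t))) (zeroˡ x))) ⟩
      0# - x + x
    ≈⟨ +-congʳ (+-identityˡ (- x)) ⟩
      - x + x
    ≈⟨ -‿inverseˡ x ⟩
      0# ∎

module TreeExtension {a b : Level} (Rg : CommutativeRing a b) (c d ℓ : ℕ) (G : BipGraph) where
  open CommutativeRing Rg
  open Tree c d ℓ G
  open Ops Rg
  open BetheHessian Rg
  open SetoidReasoning setoid
  open CommutativeSemigroupProperties *-commutativeSemigroup using (x∙yz≈y∙xz)

  fromℕ-+ : ∀ m n → fromℕ (m ℕ.+ n) ≈ fromℕ m + fromℕ n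
  fromℕ-+ zero    n = sym (+-identityˡ (fromℕ n))
  fromℕ-+ (suc m) n = trans (+-congˡ (fromℕ-+ m n)) (sym (+-assoc 1# (fromℕ m) (fromℕ n)))

  sumR-++ : ∀ xs ys → sumR (xs ++ ys) ≈ sumR xs + sumR ys
  sumR-++ []       ys = sym (+-identityˡ (sumR ys))
  sumR-++ (x ∷ xs) ys = trans (+-congˡ (sumR-++ xs ys)) (sym (+-assoc x (sumR xs) (sumR ys)))

  sumR-map-cong : ∀ {A : Set} {g h : A → Carrier} → (∀ y → g y ≈ h y) →
                  ∀ xs → sumR (map g xs) ≈ sumR (map h xs)
  sumR-map-cong g≈h []       = refl
  sumR-map-cong g≈h (y ∷ ys) = +-cong (g≈h y) (sumR-map-cong g≈h ys)

  sumR-map-const : ∀ {A : Set} (g : A → Carrier) v → (∀ y → g y ≈ v) →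
                   ∀ xs → sumR (map g xs) ≈ fromℕ (length xs) * v
  sumR-map-const g v g≈v []       = sym (zeroˡ v)
  sumR-map-const g v g≈v (y ∷ ys) = begin
    g y + sumR (map g ys)           ≈⟨ +-cong (g≈v y) (sumR-map-const g v g≈v ys) ⟩
    v + fromℕ (length ys) * v       ≈⟨ +-congʳ (*-identityˡ v) ⟨
    1# * v + fromℕ (length ys) * v  ≈⟨ distribʳ v 1# (fromℕ (length ys)) ⟨
    fromℕ (length (y ∷ ys)) * v     ∎

  sumR-select : ∀ {A : Set} (p : A → Bool) (g : A → Carrier) xs →
                sumR (map g (select p xs)) ≈ sumR (map (λ y → χ (p y) * g y) xs)
  sumR-select p g [] = refl
  sumR-select p g (x ∷ xs) with p x
  ... | true  = +-cong (sym (*-identityˡ (g x))) (sumR-select p g xs)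
  ... | false = trans (sumR-select p g xs) (sym (trans (+-congʳ (zeroˡ (g x))) (+-identityˡ _)))

  length-select : ∀ {A : Set} (p : A → Bool) xs →
                  length (select p xs) ≡.≡ sumℕ (map (λ y → b2n (p y)) xs)
  length-select p [] = ≡.refl
  length-select p (x ∷ xs) with p x
  ... | true  = ≡.cong suc (length-select p xs)
  ... | false = length-select p xs

  length-children : ∀ r k (p : Path r k) → length (children (r , k , p)) ≡.≡ nchild r k
  length-children r k p = ≡.trans (length-map _ (allFin (nchild r k))) (length-tabulate id)

  length-nbrsT-root : ∀ r → length (nbrsT (embed r)) ≡.≡ deg r ℕ.+ nchild r 0
  length-nbrsT-root r =
    ≡.trans (length-++ (map embed (nbrsG r)))
            (≡.cong₂ ℕ._+_ (≡.trans (length-map embed (nbrsG r)) (length-select (A r) allV))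
                           (length-children r 0 root))

  module _ (t : Carrier) (f : V → Carrier) where

    lift-child : ∀ r k (p : Path r k) i →
                 lift t f (r , suc k , child p i) ≈ t * lift t f (r , k , p)
    lift-child r k p i = x∙yz≈y∙xz (f r) t (pow t k)

    sumR-lift-children : ∀ r k (p : Path r k) →
                         sumR (map (lift t f) (children (r , k , p)))
                           ≈ fromℕ (nchild r k) * (t * lift t f (r , k , p))
    sumR-lift-children r k p = begin
        sumR (map (lift t f) (map (λ i → r , suc k , child p i) (allFin (nchild r k))))
      ≡⟨ ≡.cong sumR (map-∘ (allFin (nchild r k))) ⟨
        sumR (map (λ i → lift t f (r , suc k , child p i)) (allFin (nchild r k)))
      ≈⟨ sumR-map-const _ _ (lift-child r k p) (allFin (nchild r k)) ⟩
        fromℕ (length (allFin (nchild r k))) * (t * lift t f (r , k , p))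
      ≡⟨ ≡.cong (λ n → fromℕ n * (t * lift t f (r , k , p)))
                (length-tabulate {n = nchild r k} id) ⟩
        fromℕ (nchild r k) * (t * lift t f (r , k , p)) ∎

    sumR-lift-nbrsG : ∀ r → sumR (map (lift t f) (map embed (nbrsG r)))
                              ≈ sumR (map (λ y → χ (A r y) * f y) allV)
    sumR-lift-nbrsG r = begin
        sumR (map (lift t f) (map embed (nbrsG r)))
      ≡⟨ ≡.cong sumR (map-∘ (nbrsG r)) ⟨
        sumR (map (lift t f ∘ embed) (nbrsG r))
      ≈⟨ sumR-select (A r) (lift t f ∘ embed) allV ⟩
        sumR (map (λ y → χ (A r y) * (f y * 1#)) allV)
      ≈⟨ sumR-map-cong (λ y → *-congˡ (*-identityʳ (f y))) allV ⟩
        sumR (map (λ y → χ (A r y) * f y) allV) ∎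

    sumR-lift-nbrsT-root : ∀ r → sumR (map (lift t f) (nbrsT (embed r)))
                                   ≈ sumR (map (λ y → χ (A r y) * f y) allV)
                                     + fromℕ (nchild r 0) * (t * lift t f (embed r))
    sumR-lift-nbrsT-root r = begin
        sumR (map (lift t f) (map embed (nbrsG r) ++ children (embed r)))
      ≡⟨ ≡.cong sumR (map-++ (lift t f) (map embed (nbrsG r)) (children (embed r))) ⟩
        sumR (map (lift t f) (map embed (nbrsG r)) ++ map (lift t f) (children (embed r)))
      ≈⟨ sumR-++ (map (lift t f) (map embed (nbrsG r))) (map (lift t f) (children (embed r))) ⟩
        sumR (map (lift t f) (map embed (nbrsG r))) + sumR (map (lift t f) (children (embed r)))
      ≈⟨ +-cong (sumR-lift-nbrsG r) (sumR-lift-children r 0 root) ⟩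
        sumR (map (λ y → χ (A r y) * f y) allV) + fromℕ (nchild r 0) * (t * lift t f (embed r)) ∎

    HT-lift-root : ∀ r → HT t (lift t f) (embed r) ≈ HG t f r
    HT-lift-root r = begin
        HT t (lift t f) (embed r)
      ≈⟨ hessianAt-cong t degree (sumR-lift-nbrsT-root r) refl ⟩
        hessianAt (fromℕ (deg r) + fromℕ n₀) t (σ + fromℕ n₀ * (t * lift t f (embed r))) (f r * 1#)
      ≈⟨ hessianAt-children (fromℕ (deg r)) (fromℕ n₀) t σ (f r * 1#) ⟩
        hessianAt (fromℕ (deg r)) t σ (f r * 1#)
      ≈⟨ hessianAt-cong t refl refl (*-identityʳ (f r)) ⟩
        HG t f r ∎
      where
      n₀ : ℕ
      n₀ = nchild r 0
      σ : Carrier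
      σ = sumR (map (λ y → χ (A r y) * f y) allV)
      degree : fromℕ (length (nbrsT (embed r))) ≈ fromℕ (deg r) + fromℕ n₀
      degree = trans (reflexive (≡.cong fromℕ (length-nbrsT-root r))) (fromℕ-+ (deg r) n₀)

    HT-lift-nonroot : ∀ r k (p : Path r (suc k)) → HT t (lift t f) (r , suc k , p) ≈ 0#
    HT-lift-nonroot r k p@(child q i) = begin
        HT t (lift t f) x
      ≈⟨ hessianAt-cong t (+-congˡ (reflexive (≡.cong fromℕ (length-children r (suc k) p))))
                          (+-congˡ (sumR-lift-children r (suc k) p)) refl ⟩
        hessianAt (1# + fromℕ n) t (lift t f parent + fromℕ n * (t * lift t f x)) (lift t f x)
      ≈⟨ hessianAt-children 1# (fromℕ n) t (lift t f parent) (lift t f x) ⟩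
        hessianAt 1# t (lift t f parent) (lift t f x)
      ≈⟨ hessianAt-leaf t (lift t f parent) (lift t f x) (sym (lift-child r k q i)) ⟩
        0# ∎
      where
      x parent : VT
      x      = r , suc k , p
      parent = r , k , q
      n : ℕ
      n = nchild r (suc k)

mainTheorem17 : ∀ {a b : Level} (Rg : CommutativeRing a b) (c d ℓ : ℕ) (G : BipGraph) →
    2 ≤ c → 2 ≤ d → 1 < ℓ → 2 ∣ ℓ →
    (∀ u → BG.deg G (inj₁ u) ≤ c) → (∀ v → BG.deg G (inj₂ v) ≤ d) →
    (t : CommutativeRing.Carrier Rg) (f : BG.V G → CommutativeRing.Carrier Rg) →
    ((r : BG.V G) →
      CommutativeRing._≈_ Rg
        (Tree.Ops.HT c d ℓ G Rg t (Tree.Ops.lift c d ℓ G Rg t f) (Tree.embed c d ℓ G r))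
        (Tree.Ops.HG c d ℓ G Rg t f r))
    ×
    ((r : BG.V G) (k : ℕ) (p : Tree.Path c d ℓ G r (suc k)) →
      CommutativeRing._≈_ Rg
        (Tree.Ops.HT c d ℓ G Rg t (Tree.Ops.lift c d ℓ G Rg t f) (r , suc k , p))
        (CommutativeRing.0# Rg))
mainTheorem17 Rg c d ℓ G _ _ _ _ _ _ t f =
  HT-lift-root t f , HT-lift-nonroot t f
  where open TreeExtension Rg c d ℓ G
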